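{- $\mathbf{VC}$-tableaux are sound for $\mathbf{VC}$-models: if $\Delta$ is a set of formulas such that there is a closed $\mathbf{VC}$-tableau with assumptions $\{1\triangleright\theta:\theta\in\Delta\}$, then $\Delta$ is not satisfiable in any $\mathbf{VC}$-model (there is no $\mathbf{VC}$-model $M$ and world $x$ at which all formulas of $\Delta$ are true).
   Context: Formulas are built from propositional variables and $\bot$ using $\lnot,\supset,\land,\lor$ and a binary operator: if $\phi,\psi$ are formulas, so is $\Box_\phi\psi$. Abbreviations: $\top:=\lnot\bot$, $\Diamond_\phi\psi:=\lnot\Box_\phi\lnot\psi$. A Segerberg model $M=\langle U,P,R,V\rangle$ has a nonempty set $U$, a set $P\subseteq\wp(U)$ with $\emptyset,U\in P$, closed under complement, intersection, union, and such that $S,T\in P$ implies $\{x\in U: R_S(x)\subseteq T\}\in P$; a map $R$ assigning to each $S\in P$ a relation $R_S\subseteq U\times U$ (write $R_S(x)=\{y: xR_Sy\}$); and $V$ mapping propositional variables into $P$. Truth: $x\not\models\bot$; $x\models p$ iff $x\in V(p)$; usual clauses for $\land,\lor,\supset,\lnot$; $x\models\Box_\phi\psi$ iff every $y$ with $xR_{[\phi]}y$ satisfies $\psi$, where $[\phi]=\{x: M,x\models\phi\}$. A $\mathbf{VC}$-model is a Segerberg model such that for all $S,T\in P$, $x\in U$: (1) $R_S(x)\subseteq S$; (2) $R_S(x)\cap T\neq\emptyset\Rightarrow R_T(x)\neq\emptyset$; (3) $R_U(x)\subseteq\{x\}$; (4) $x\in R_U(x)$; (5) $R_S(x)\cap T\subseteq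 R_{S\cap T}(x)$; (6) $R_S(x)\cap T\neq\emptyset\Rightarrow R_{S\cap T}(x)\subseteq R_S(x)\cap T$. Prefixed formulas are $i\triangleright\phi$ and $i\,r_\phi\,j$ ($i,j$ positive integers). $\mathbf{VC}$ tableau rules (premises $\Rightarrow$ conclusions; "$|$" separates branches): $i\triangleright\phi\land\psi\Rightarrow i\triangleright\phi,\ i\triangleright\psi$; $i\triangleright\lnot(\phi\land\psi)\Rightarrow i\triangleright\lnot\phi\ |\ i\triangleright\lnot\psi$; $i\triangleright\phi\lor\psi\Rightarrow i\triangleright\phi\ |\ i\triangleright\psi$; $i\triangleright\lnot(\phi\lor\psi)\Rightarrow i\triangleright\lnot\phi,\ i\triangleright\lnot\psi$; $i\triangleright\phi\supset\psi\Rightarrow i\triangleright\lnot\phi\ |\ i\triangleright\psi$; $i\triangleright\lnot(\phi\supset\psi)\Rightarrow i\triangleright\phi,\ i\triangleright\lnot\psi$; $i\triangleright\lnot\lnot\phi\Rightarrow i\triangleright\phi$; ($\Box$) $i\triangleright\Box_\phi\psi$ and $i\,r_\phi\,j\Rightarrow j\triangleright\psi$; ($\lnot\Box$) $i\triangleright\lnot\Box_\phi\psi\Rightarrow i\,r_\phi\,j,\ j\triangleright\lnot\psi$, $j$ new to the branch; ($\Diamond$) $i\triangleright\Diamond_\phi\psi\Rightarrow i\,r_\phi\,j,\ j\triangleright\psi$, $j$ new; ($\lnot\Diamond$) $i\triangleright\lnot\Diamond_\phi\psi$ and $i\,r_\phi\,j\Rightarrow j\triangleright\lnot\psi$; (cut)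 no premises $\Rightarrow i\triangleright\phi\ |\ i\triangleright\lnot\phi$, $i$ already on the branch; (ea) $i\,r_\phi\,j\Rightarrow(k\triangleright\lnot\phi,\ k\triangleright\psi)\ |\ (k\triangleright\phi,\ k\triangleright\lnot\psi)\ |\ i\,r_\psi\,j$, any $\psi$, $k$ new; (R1) $i\,r_\phi\,j\Rightarrow j\triangleright\phi$; (R2) $j\triangleright\psi$, $i\,r_\phi\,j\Rightarrow i\,r_\psi\,k$, $k$ new; (R3) $i\triangleright\phi$, $j\triangleright\lnot\phi$, $i\,r_\top\,j\Rightarrow j\triangleright\phi$; (R4) no premises $\Rightarrow i\,r_\top\,i$, $i$ on the branch; (R5) $j\triangleright\psi$, $i\,r_\phi\,j\Rightarrow i\,r_{\phi\land\psi}\,j$; (R6) $j\triangleright\psi$, $i\,r_\phi\,j$, $i\,r_{\phi\land\psi}\,k\Rightarrow k\triangleright\psi,\ i\,r_\phi\,k$. A tableau is a downward-branching tree of prefixed formulas each an assumption or a conclusion of a rule applied to formulas above it on its branch (conclusions of a branching rule as siblings); a branch is closed if it contains $i\triangleright\theta$ and $i\triangleright\lnot\theta$, or $i\triangleright\bot$; the tableau is closed if all branches are. -}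

module Defs where

open import Data.Nat using (ℕ)
open import Data.Bool as B using (Bool; true; false)
open import Data.List using (List; []; _∷_; _++_)
open import Data.List.Membership.Propositional using (_∈_)
open import Data.List.Relation.Unary.All using (All)
open import Data.List.Relation.Unary.Any using (Any)
open import Data.Product using (Σ; Σ-syntax; ∃; ∃-syntax; _×_; proj₁; proj₂)
open import Data.Sum using (_⊎_)
open import Function.Bundles using (_⇔_)
open import Relation.Nullary using (¬_)
open import Relation.Binary.PropositionalEquality using (_≡_)

infixr 8 _⊃_
infixr 9 _∨f_
infixr 10 _∧f_

data Formula : Set where
  var  : ℕ → Formula
  ⊥f   : Formula
  ¬f   : Formula → Formula
  _⊃_  : Formula → Formula → Formula
  _∧f_ : Formula → Formula → Formula
  _∨f_ : Formula → Formula → Formula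
  □    : Formula → Formula → Formula

⊤f : Formula
⊤f = ¬f ⊥f

◇ : Formula → Formula → Formula
◇ φ ψ = ¬f (□ φ (¬f ψ))

-- Segerberg models.  Subsets of U are represented by characteristic
-- functions U → Bool (the paper's metatheory is classical).

Subset : Set → Set
Subset U = U → Bool

record SegerbergModel : Set₁ where
  field
    U        : Set
    nonempty : U
    P        : Subset U → Set
    -- P is a set of *sets*: membership is invariant under extensional equality
    P-ext    : ∀ {S T} → P S → (∀ x → S x ≡ T x) → P T
    P-∅      : P (λ _ → false)
    P-U      : P (λ _ → true)
    P-compl  : ∀ {S} → P S → P (λ x → B.not (S x))
    P-∩      : ∀ {S T} → P S → P T → P (λ x → S x B.∧ T x)
    P-∪      : ∀ {S T} → P S → P T → P (λ x → S x B.∨ T x)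
    -- R_S, for each set S (only S ∈ P matter)
    R        : Subset U → U → U → Set
    -- R is a function of the set S
    R-ext    : ∀ {S T x y} → (∀ z → S z ≡ T z) → R S x y → R T x y
    P-box    : ∀ {S T} → P S → P T →
               Σ[ X ∈ Subset U ] (P X ×
                 (∀ x → (X x ≡ true) ⇔ (∀ y → R S x y → T y ≡ true)))
    V        : ℕ → Subset U
    V-P      : ∀ p → P (V p)

module Semantics (M : SegerbergModel) where
  open SegerbergModel M

  ⟦_⟧ : Formula → Σ (Subset U) P
  ⟦ var p ⟧   = V p , V-P p
    where open Data.Product using (_,_)
  ⟦ ⊥f ⟧      = (λ _ → false) , P-∅
    where open Data.Product using (_,_)
  ⟦ ¬f φ ⟧    = (λ x → B.not (proj₁ ⟦ φ ⟧ x)) , P-compl (proj₂ ⟦ φ ⟧)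
    where open Data.Product using (_,_)
  ⟦ φ ⊃ ψ ⟧   = (λ x → B.not (proj₁ ⟦ φ ⟧ x) B.∨ proj₁ ⟦ ψ ⟧ x)
              , P-∪ (P-compl (proj₂ ⟦ φ ⟧)) (proj₂ ⟦ ψ ⟧)
    where open Data.Product using (_,_)
  ⟦ φ ∧f ψ ⟧  = (λ x → proj₁ ⟦ φ ⟧ x B.∧ proj₁ ⟦ ψ ⟧ x) , P-∩ (proj₂ ⟦ φ ⟧) (proj₂ ⟦ ψ ⟧)
    where open Data.Product using (_,_)
  ⟦ φ ∨f ψ ⟧  = (λ x → proj₁ ⟦ φ ⟧ x B.∨ proj₁ ⟦ ψ ⟧ x) , P-∪ (proj₂ ⟦ φ ⟧) (proj₂ ⟦ ψ ⟧)
    where open Data.Product using (_,_)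
  ⟦ □ φ ψ ⟧   = proj₁ box , proj₁ (proj₂ box)
    where
      open Data.Product using (_,_)
      box = P-box (proj₂ ⟦ φ ⟧) (proj₂ ⟦ ψ ⟧)

  [_] : Formula → Subset U
  [ φ ] = proj₁ ⟦ φ ⟧

  _⊨_ : U → Formula → Set
  x ⊨ φ = [ φ ] x ≡ true

record IsVC (M : SegerbergModel) : Set where
  open SegerbergModel M
  field
    vc1 : ∀ {S x y} → P S → R S x y → S y ≡ true
    vc2 : ∀ {S T x y} → P S → P T → R S x y → T y ≡ true → ∃[ z ] R T x z
    vc3 : ∀ {x y} → R (λ _ → true) x y → y ≡ x
    vc4 : ∀ {x} → R (λ _ → true) x x
    vc5 : ∀ {S T x y} → P S → P T → R S x y → T y ≡ true →
          R (λ z → S z B.∧ T z) x y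
    vc6 : ∀ {S T x y} → P S → P T → (∃[ w ] (R S x w × T w ≡ true)) →
          R (λ z → S z B.∧ T z) x y → R S x y × T y ≡ true

infix 6 _▷_
data PFormula : Set where
  _▷_ : ℕ → Formula → PFormula
  rel : ℕ → Formula → ℕ → PFormula

Branch : Set
Branch = List PFormula

data LabelOf (i : ℕ) : PFormula → Set where
  lab▷  : ∀ {φ} → LabelOf i (i ▷ φ)
  labr₁ : ∀ {φ j} → LabelOf i (rel i φ j)
  labr₂ : ∀ {φ j} → LabelOf i (rel j φ i)

OnBranch : ℕ → Branch → Set
OnBranch i B = Any (LabelOf i) B

New : ℕ → Branch → Set
New k B = ¬ OnBranch k B

ClosedBranch : Branch → Set
ClosedBranch B = (∃[ i ] ∃[ θ ] ((i ▷ θ) ∈ B × (i ▷ ¬f θ) ∈ B)) ⊎ (∃[ i ] ((i ▷ ⊥f) ∈ B))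

-- Rule B Cs : some VC tableau rule has its premises on branch B and
-- yields the list of branch-extensions Cs (one list of conclusions per
-- branch of the rule).
data Rule (B : Branch) : List Branch → Set where
  r∧   : ∀ {i φ ψ} → (i ▷ φ ∧f ψ) ∈ B → Rule B ((i ▷ φ ∷ i ▷ ψ ∷ []) ∷ [])
  r¬∧  : ∀ {i φ ψ} → (i ▷ ¬f (φ ∧f ψ)) ∈ B →
         Rule B ((i ▷ ¬f φ ∷ []) ∷ (i ▷ ¬f ψ ∷ []) ∷ [])
  r∨   : ∀ {i φ ψ} → (i ▷ φ ∨f ψ) ∈ B → Rule B ((i ▷ φ ∷ []) ∷ (i ▷ ψ ∷ []) ∷ [])
  r¬∨  : ∀ {i φ ψ} → (i ▷ ¬f (φ ∨f ψ)) ∈ B →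
         Rule B ((i ▷ ¬f φ ∷ i ▷ ¬f ψ ∷ []) ∷ [])
  r⊃   : ∀ {i φ ψ} → (i ▷ φ ⊃ ψ) ∈ B → Rule B ((i ▷ ¬f φ ∷ []) ∷ (i ▷ ψ ∷ []) ∷ [])
  r¬⊃  : ∀ {i φ ψ} → (i ▷ ¬f (φ ⊃ ψ)) ∈ B → Rule B ((i ▷ φ ∷ i ▷ ¬f ψ ∷ []) ∷ [])
  r¬¬  : ∀ {i φ} → (i ▷ ¬f (¬f φ)) ∈ B → Rule B ((i ▷ φ ∷ []) ∷ [])
  r□   : ∀ {i j φ ψ} → (i ▷ □ φ ψ) ∈ B → rel i φ j ∈ B → Rule B ((j ▷ ψ ∷ []) ∷ [])
  r¬□  : ∀ {i j φ ψ} → (i ▷ ¬f (□ φ ψ)) ∈ B → New j B →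
         Rule B ((rel i φ j ∷ j ▷ ¬f ψ ∷ []) ∷ [])
  r◇   : ∀ {i j φ ψ} → (i ▷ ◇ φ ψ) ∈ B → New j B →
         Rule B ((rel i φ j ∷ j ▷ ψ ∷ []) ∷ [])
  r¬◇  : ∀ {i j φ ψ} → (i ▷ ¬f (◇ φ ψ)) ∈ B → rel i φ j ∈ B →
         Rule B ((j ▷ ¬f ψ ∷ []) ∷ [])
  rcut : ∀ {i φ} → OnBranch i B → Rule B ((i ▷ φ ∷ []) ∷ (i ▷ ¬f φ ∷ []) ∷ [])
  rea  : ∀ {i j k φ ψ} → rel i φ j ∈ B → New k B →
         Rule B ((k ▷ ¬f φ ∷ k ▷ ψ ∷ []) ∷ (k ▷ φ ∷ k ▷ ¬f ψ ∷ []) ∷ (rel i ψ j ∷ []) ∷ [])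
  rR1  : ∀ {i j φ} → rel i φ j ∈ B → Rule B ((j ▷ φ ∷ []) ∷ [])
  rR2  : ∀ {i j k φ ψ} → (j ▷ ψ) ∈ B → rel i φ j ∈ B → New k B →
         Rule B ((rel i ψ k ∷ []) ∷ [])
  rR3  : ∀ {i j φ} → (i ▷ φ) ∈ B → (j ▷ ¬f φ) ∈ B → rel i ⊤f j ∈ B →
         Rule B ((j ▷ φ ∷ []) ∷ [])
  rR4  : ∀ {i} → OnBranch i B → Rule B ((rel i ⊤f i ∷ []) ∷ [])
  rR5  : ∀ {i j φ ψ} → (j ▷ ψ) ∈ B → rel i φ j ∈ B → Rule B ((rel i (φ ∧f ψ) j ∷ []) ∷ [])
  rR6  : ∀ {i j k φ ψ} → (j ▷ ψ) ∈ B → rel i φ j ∈ B → rel i (φ ∧f ψ) k ∈ B →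
         Rule B ((k ▷ ψ ∷ rel i φ k ∷ []) ∷ [])

-- ClosedTableau Δ B : the branch B (newest formula first) can be grown
-- into a finite tableau all of whose branches are closed, where at any
-- point an assumption 1 ▷ θ (θ ∈ Δ) may be added, or a rule applied.
data ClosedTableau (Δ : Formula → Set) : Branch → Set where
  close  : ∀ {B} → ClosedBranch B → ClosedTableau Δ B
  assume : ∀ {B θ} → Δ θ → ClosedTableau Δ ((1 ▷ θ) ∷ B) → ClosedTableau Δ B
  apply  : ∀ {B Cs} → Rule B Cs → All (λ C → ClosedTableau Δ (C ++ B)) Cs →
           ClosedTableau Δ B

VC-Satisfiable : (Formula → Set) → Set₁
VC-Satisfiable Δ =
  Σ[ M ∈ SegerbergModel ] (IsVC M ×
    Σ[ x ∈ SegerbergModel.U M ] (∀ θ → Δ θ → Semantics._⊨_ M x θ))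

-- Fix a VC-model M and a world x satisfying Δ.  An assignment f : ℕ → U
-- interprets prefixes as worlds; it satisfies a branch when every prefixed
-- formula on it holds (i ▷ φ means f i ⊨ φ, i r_φ j means f i R_[φ] f j).
-- Call a branch refuted when no assignment with f 1 ≡ x satisfies it.
-- The argument is the usual one, read contrapositively so that it stays
-- constructive:
--   * closed branches are refuted;
--   * every rule is sound: if all branches a rule produces from B are
--     refuted, so is B.  Rules with a fresh prefix k are handled by
--     re-assigning k to the witness world; the VC conditions (1)-(6)
--     justify the rules R1-R6;
--   * hence, by induction on the tableau, every branch mentioning prefix 1
--     that starts a closed tableau is refuted.
-- A closed tableau for Δ must begin with an assumption 1 ▷ θ (no rule
-- applies to the empty branch), and the branch [1 ▷ θ] is satisfied by
-- the constant assignment at x: this contradicts refutation.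

module Submission where

open import Defs
open import Data.List using ([])
open import Relation.Nullary using (¬_)

open import Data.Nat using (ℕ; _≟_)
open import Data.Bool using (true; false; not; _∧_; _∨_)
open import Data.Bool.Properties using (∧-conicalˡ; ∧-conicalʳ; not-involutive)
open import Data.List using (_∷_; _++_)
open import Data.List.Membership.Propositional using (_∈_; lose)
open import Data.List.Relation.Unary.All using (All; _∷_; []; lookup)
open import Data.List.Relation.Unary.All.Properties using (++⁺)
open import Data.List.Relation.Unary.Any using (here; there)
open import Data.List.Relation.Unary.Any.Properties using (++⁺ʳ)
open import Data.Product using (_,_; proj₁; proj₂; _×_)
open import Data.Sum using (_⊎_; inj₁; inj₂)
open import Data.Empty using (⊥; ⊥-elim)
open import Function.Base using (_∘_)
open import Function.Bundles using (Equivalence; _⇔_)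
open import Relation.Nullary using (yes; no)
open import Relation.Binary.PropositionalEquality
  using (_≡_; _≢_; refl; sym; trans; subst; subst₂)

-- Truth tables of the connectives, phrased as facts about  b ≡ true.
-- All classical reasoning of the proof happens here, on booleans.

excluded-middle : ∀ b → b ≡ true ⊎ not b ≡ true
excluded-middle true  = inj₁ refl
excluded-middle false = inj₂ refl

not-both : ∀ {b} → b ≡ true → not b ≡ true → ⊥
not-both refl ()

not-not : ∀ {b} → not (not b) ≡ true → b ≡ true
not-not {b} h = trans (sym (not-involutive b)) h

∨-true : ∀ {a b} → a ∨ b ≡ true → a ≡ true ⊎ b ≡ true
∨-true {true}  _ = inj₁ refl
∨-true {false} h = inj₂ h

not-∧ : ∀ {a b} → not (a ∧ b) ≡ true → not a ≡ true ⊎ not b ≡ true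
not-∧ {false} _ = inj₁ refl
not-∧ {true}  h = inj₂ h

not-∨ : ∀ {a b} → not (a ∨ b) ≡ true → not a ≡ true × not b ≡ true
not-∨ {false} h = refl , h

refute-not : ∀ {b} → ¬ (not b ≡ true) → b ≡ true
refute-not {true}  _ = refl
refute-not {false} h = ⊥-elim (h refl)

agree : ∀ {a b} → ¬ (not a ≡ true × b ≡ true) → ¬ (a ≡ true × not b ≡ true) →
        a ≡ b
agree {true}  {true}  _  _  = refl
agree {false} {false} _  _  = refl
agree {false} {true}  h₁ _  = ⊥-elim (h₁ (refl , refl))
agree {true}  {false} _  h₂ = ⊥-elim (h₂ (refl , refl))

module Interpretation (M : SegerbergModel) where
  open SegerbergModel M
  open Semantics M

  holds : (ℕ → U) → PFormula → Set
  holds f (i ▷ φ)     = f i ⊨ φ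
  holds f (rel i φ j) = R [ φ ] (f i) (f j)

  Sat : (ℕ → U) → Branch → Set
  Sat f B = All (holds f) B

  ⊨□ : ∀ φ ψ y → (y ⊨ □ φ ψ) ⇔ (∀ z → R [ φ ] y z → z ⊨ ψ)
  ⊨□ φ ψ y = proj₂ (proj₂ (P-box (proj₂ ⟦ φ ⟧) (proj₂ ⟦ ψ ⟧))) y

  holds-cong : ∀ {f g} p → (∀ i → LabelOf i p → f i ≡ g i) → holds f p → holds g p
  holds-cong (i ▷ φ)     e h = subst (_⊨ φ) (e i lab▷) h
  holds-cong (rel i φ j) e h = subst₂ (R [ φ ]) (e i labr₁) (e j labr₂) h

  _[_↦_] : (ℕ → U) → ℕ → U → ℕ → U
  (f [ k ↦ w ]) i with i ≟ k
  ... | yes _ = w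
  ... | no  _ = f i

  update-here : ∀ f k w → (f [ k ↦ w ]) k ≡ w
  update-here f k w with k ≟ k
  ... | yes _ = refl
  ... | no  k≢k = ⊥-elim (k≢k refl)

  update-elsewhere : ∀ f {k} w {i} → i ≢ k → (f [ k ↦ w ]) i ≡ f i
  update-elsewhere f {k} w {i} i≢k with i ≟ k
  ... | yes i≡k = ⊥-elim (i≢k i≡k)
  ... | no  _   = refl

  fresh-label : ∀ {i k B} → New k B → OnBranch i B → i ≢ k
  fresh-label new o refl = new o

  update-sat : ∀ {f k w B} → New k B → Sat f B → Sat (f [ k ↦ w ]) B
  update-sat new [] = []
  update-sat {f} {k} {w} {p ∷ B} new (h ∷ s) =
    holds-cong p (λ i l → sym (update-elsewhere f w (fresh-label new (here l)))) h
    ∷ update-sat (new ∘ there) s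

  -- Facts about the world w placed at the prefix k.  The arguments are
  -- explicit since Agda cannot infer them from the unfolded types.
  ▷-fresh : ∀ f k {w} φ → w ⊨ φ → holds (f [ k ↦ w ]) (k ▷ φ)
  ▷-fresh f k {w} φ = subst (_⊨ φ) (sym (update-here f k w))

  rel-fresh : ∀ f k {i w} φ → i ≢ k → R [ φ ] (f i) w →
              holds (f [ k ↦ w ]) (rel i φ k)
  rel-fresh f k {i} {w} φ i≢k =
    subst₂ (R [ φ ]) (sym (update-elsewhere f w i≢k)) (sym (update-here f k w))

module Soundness (M : SegerbergModel) (vc : IsVC M) (x : SegerbergModel.U M) where
  open SegerbergModel M
  open Semantics M
  open IsVC vc
  open Interpretation M

  Refuted : Branch → Set
  Refuted B = ∀ f → f 1 ≡ x → Sat f B → ⊥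

  closed-refuted : ∀ {B} → ClosedBranch B → Refuted B
  closed-refuted (inj₁ (_ , _ , θ∈B , ¬θ∈B)) f _ s =
    not-both (lookup s θ∈B) (lookup s ¬θ∈B)
  closed-refuted (inj₂ (_ , ⊥∈B))            f _ s with lookup s ⊥∈B
  ... | ()

  branch-on : ∀ {B p q} f → holds f p ⊎ holds f q →
              Refuted (p ∷ B) → Refuted (q ∷ B) → f 1 ≡ x → Sat f B → ⊥
  branch-on f (inj₁ hp) h₁ _  f₁ s = h₁ f f₁ (hp ∷ s)
  branch-on f (inj₂ hq) _  h₂ f₁ s = h₂ f f₁ (hq ∷ s)

  root-kept : ∀ {B f k} w → New k B → OnBranch 1 B → f 1 ≡ x → (f [ k ↦ w ]) 1 ≡ x
  root-kept {f = f} w new o₁ f₁ = trans (update-elsewhere f w (fresh-label new o₁)) f₁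

  -- (¬□): the fresh successor would witness the failure of □_φ ψ.
  ¬□-sound : ∀ {B i j φ ψ} → (i ▷ ¬f (□ φ ψ)) ∈ B → New j B → OnBranch 1 B →
             Refuted ((rel i φ j ∷ j ▷ ¬f ψ ∷ []) ++ B) → Refuted B
  ¬□-sound {i = i} {j} {φ} {ψ} m new o₁ h f f₁ s =
    not-both (Equivalence.from (⊨□ φ ψ (f i)) all-ψ) (lookup s m)
    where
      all-ψ : ∀ y → R [ φ ] (f i) y → y ⊨ ψ
      all-ψ y r = refute-not λ ¬ψ → h (f [ j ↦ y ]) (root-kept y new o₁ f₁)
        ( rel-fresh f j φ (fresh-label new (lose m lab▷)) r
        ∷ ▷-fresh f j (¬f ψ) ¬ψ
        ∷ update-sat new s)

  -- (◇): as (¬□), since ◇_φ ψ is ¬ □_φ ¬ψ.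
  ◇-sound : ∀ {B i j φ ψ} → (i ▷ ◇ φ ψ) ∈ B → New j B → OnBranch 1 B →
            Refuted ((rel i φ j ∷ j ▷ ψ ∷ []) ++ B) → Refuted B
  ◇-sound {i = i} {j} {φ} {ψ} m new o₁ h f f₁ s =
    not-both (Equivalence.from (⊨□ φ (¬f ψ) (f i)) all-¬ψ) (lookup s m)
    where
      all-¬ψ : ∀ y → R [ φ ] (f i) y → y ⊨ ¬f ψ
      all-¬ψ y r = refute-not λ ¬¬ψ → h (f [ j ↦ y ]) (root-kept y new o₁ f₁)
        ( rel-fresh f j φ (fresh-label new (lose m lab▷)) r
        ∷ ▷-fresh f j ψ (not-not ¬¬ψ)
        ∷ update-sat new s)

  -- (ea): if no fresh world separates φ from ψ, then [φ] = [ψ], and R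
  -- depends only on the set [φ].
  ea-sound : ∀ {B i j k φ ψ} → rel i φ j ∈ B → New k B → OnBranch 1 B →
             Refuted ((k ▷ ¬f φ ∷ k ▷ ψ ∷ []) ++ B) →
             Refuted ((k ▷ φ ∷ k ▷ ¬f ψ ∷ []) ++ B) →
             Refuted ((rel i ψ j ∷ []) ++ B) → Refuted B
  ea-sound {k = k} {φ = φ} {ψ} m new o₁ h₁ h₂ h₃ f f₁ s =
    h₃ f f₁ (R-ext same-set (lookup s m) ∷ s)
    where
      same-set : ∀ z → [ φ ] z ≡ [ ψ ] z
      same-set z = agree
        (λ (¬φ , ψ′) → h₁ (f [ k ↦ z ]) (root-kept z new o₁ f₁)
           (▷-fresh f k (¬f φ) ¬φ ∷ ▷-fresh f k ψ ψ′ ∷ update-sat new s))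
        (λ (φ′ , ¬ψ) → h₂ (f [ k ↦ z ]) (root-kept z new o₁ f₁)
           (▷-fresh f k φ φ′ ∷ ▷-fresh f k (¬f ψ) ¬ψ ∷ update-sat new s))

  -- (R2): condition (2) provides an R_[ψ]-successor to place at k.
  R2-sound : ∀ {B i j k φ ψ} → (j ▷ ψ) ∈ B → rel i φ j ∈ B → New k B →
             OnBranch 1 B → Refuted ((rel i ψ k ∷ []) ++ B) → Refuted B
  R2-sound {k = k} {φ = φ} {ψ} m r new o₁ h f f₁ s
    with vc2 (proj₂ ⟦ φ ⟧) (proj₂ ⟦ ψ ⟧) (lookup s r) (lookup s m)
  ... | z , rz = h (f [ k ↦ z ]) (root-kept z new o₁ f₁)
    (rel-fresh f k ψ (fresh-label new (lose r labr₁)) rz ∷ update-sat new s)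

  rule-sound : ∀ {B Cs} → OnBranch 1 B → Rule B Cs →
               All (λ C → Refuted (C ++ B)) Cs → Refuted B
  rule-sound o₁ (r∧ m) (h ∷ []) f f₁ s =
    h f f₁ (∧-conicalˡ _ _ (lookup s m) ∷ ∧-conicalʳ _ _ (lookup s m) ∷ s)
  rule-sound o₁ (r¬∧ m) (h₁ ∷ h₂ ∷ []) f f₁ s =
    branch-on f (not-∧ (lookup s m)) h₁ h₂ f₁ s
  rule-sound o₁ (r∨ m) (h₁ ∷ h₂ ∷ []) f f₁ s =
    branch-on f (∨-true (lookup s m)) h₁ h₂ f₁ s
  rule-sound o₁ (r¬∨ m) (h ∷ []) f f₁ s =
    h f f₁ (proj₁ (not-∨ (lookup s m)) ∷ proj₂ (not-∨ (lookup s m)) ∷ s)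
  rule-sound o₁ (r⊃ m) (h₁ ∷ h₂ ∷ []) f f₁ s =
    branch-on f (∨-true (lookup s m)) h₁ h₂ f₁ s
  rule-sound o₁ (r¬⊃ m) (h ∷ []) f f₁ s =
    h f f₁ (not-not (proj₁ (not-∨ (lookup s m))) ∷ proj₂ (not-∨ (lookup s m)) ∷ s)
  rule-sound o₁ (r¬¬ m) (h ∷ []) f f₁ s = h f f₁ (not-not (lookup s m) ∷ s)
  rule-sound o₁ (r□ {i} {j} {φ} {ψ} m r) (h ∷ []) f f₁ s =
    h f f₁ (Equivalence.to (⊨□ φ ψ (f i)) (lookup s m) (f j) (lookup s r) ∷ s)
  rule-sound o₁ (r¬□ m new) (h ∷ []) = ¬□-sound m new o₁ h
  rule-sound o₁ (r◇ m new) (h ∷ []) = ◇-sound m new o₁ h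
  rule-sound o₁ (r¬◇ {i} {j} {φ} {ψ} m r) (h ∷ []) f f₁ s =
    h f f₁ (Equivalence.to (⊨□ φ (¬f ψ) (f i)) (not-not (lookup s m)) (f j) (lookup s r)
           ∷ s)
  rule-sound o₁ (rcut {i} {φ} _) (h₁ ∷ h₂ ∷ []) f f₁ s =
    branch-on f (excluded-middle ([ φ ] (f i))) h₁ h₂ f₁ s
  rule-sound o₁ (rea r new) (h₁ ∷ h₂ ∷ h₃ ∷ []) = ea-sound r new o₁ h₁ h₂ h₃
  rule-sound o₁ (rR1 {φ = φ} r) (h ∷ []) f f₁ s =
    h f f₁ (vc1 (proj₂ ⟦ φ ⟧) (lookup s r) ∷ s)
  rule-sound o₁ (rR2 m r new) (h ∷ []) = R2-sound m r new o₁ h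
  rule-sound o₁ (rR3 {φ = φ} m _ r) (h ∷ []) f f₁ s =
    h f f₁ (subst (_⊨ φ) (sym (vc3 (lookup s r))) (lookup s m) ∷ s)
  rule-sound o₁ (rR4 _) (h ∷ []) f f₁ s = h f f₁ (vc4 ∷ s)
  rule-sound o₁ (rR5 {φ = φ} {ψ} m r) (h ∷ []) f f₁ s =
    h f f₁ (vc5 (proj₂ ⟦ φ ⟧) (proj₂ ⟦ ψ ⟧) (lookup s r) (lookup s m) ∷ s)
  rule-sound o₁ (rR6 {i} {j} {k} {φ} {ψ} m r r-k) (h ∷ []) f f₁ s =
    h f f₁ (proj₂ k-facts ∷ proj₁ k-facts ∷ s)
    where
      -- f j witnesses that R_[φ](f i) meets [ψ], so condition (6) applies.
      k-facts : R [ φ ] (f i) (f k) × f k ⊨ ψ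
      k-facts = vc6 (proj₂ ⟦ φ ⟧) (proj₂ ⟦ ψ ⟧) (f j , lookup s r , lookup s m)
                    (lookup s r-k)

  mutual
    tableau-sound : ∀ {Δ B} → (∀ θ → Δ θ → x ⊨ θ) → OnBranch 1 B →
                    ClosedTableau Δ B → Refuted B
    tableau-sound x⊨Δ o₁ (close c) = closed-refuted c
    tableau-sound x⊨Δ o₁ (assume {θ = θ} d t) f f₁ s =
      tableau-sound x⊨Δ (there o₁) t f f₁ (subst (_⊨ θ) (sym f₁) (x⊨Δ θ d) ∷ s)
    tableau-sound x⊨Δ o₁ (apply r ts) = rule-sound o₁ r (extensions-sound x⊨Δ o₁ ts)

    extensions-sound : ∀ {Δ B Cs} → (∀ θ → Δ θ → x ⊨ θ) → OnBranch 1 B →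
                       All (λ C → ClosedTableau Δ (C ++ B)) Cs →
                       All (λ C → Refuted (C ++ B)) Cs
    extensions-sound x⊨Δ o₁ [] = []
    extensions-sound x⊨Δ o₁ (_∷_ {x = C} t ts) =
      tableau-sound x⊨Δ (++⁺ʳ C o₁) t ∷ extensions-sound x⊨Δ o₁ ts

no-rule-on-empty-branch : ∀ {Cs} → ¬ Rule [] Cs
no-rule-on-empty-branch (r∧ ())
no-rule-on-empty-branch (r¬∧ ())
no-rule-on-empty-branch (r∨ ())
no-rule-on-empty-branch (r¬∨ ())
no-rule-on-empty-branch (r⊃ ())
no-rule-on-empty-branch (r¬⊃ ())
no-rule-on-empty-branch (r¬¬ ())
no-rule-on-empty-branch (r□ () _)
no-rule-on-empty-branch (r¬□ () _)
no-rule-on-empty-branch (r◇ () _)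
no-rule-on-empty-branch (r¬◇ () _)
no-rule-on-empty-branch (rcut ())
no-rule-on-empty-branch (rea () _)
no-rule-on-empty-branch (rR1 ())
no-rule-on-empty-branch (rR2 () _ _)
no-rule-on-empty-branch (rR3 () _ _)
no-rule-on-empty-branch (rR4 ())
no-rule-on-empty-branch (rR5 () _)
no-rule-on-empty-branch (rR6 () _ _)

theorem2 : (Δ : Formula → Set) → ClosedTableau Δ [] → ¬ VC-Satisfiable Δ
theorem2 Δ (close (inj₁ (_ , _ , () , _)))
theorem2 Δ (close (inj₂ (_ , ())))
theorem2 Δ (apply r _) _ = no-rule-on-empty-branch r
theorem2 Δ (assume {θ = θ} d t) (M , vc , x , x⊨Δ) =
  tableau-sound x⊨Δ (here lab▷) t (λ _ → x) refl (x⊨Δ θ d ∷ [])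
  where open Soundness M vc x
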